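{- For all $n\in\mathbb{N}$, \[\operatorname{inv}(n)\leq \left\lfloor\frac{n-1}{2}\right\rfloor+\operatorname{inv}\left(\left\lceil\frac{n-1}{2}\right\rceil\right).\]
   Context: For a digraph $D$ and $X\subseteq V(D)$, inverting $X$ in $D$ means reversing the direction of every edge with both endpoints in $X$. A family $X_1,\dots,X_k\subseteq V(D)$ is a decycling family of $D$ if inverting $X_1,\dots,X_k$ in turn yields an acyclic digraph; $\operatorname{inv}(D)$ is the minimum size of a decycling family. For $m\in\mathbb{N}_0$, $\operatorname{inv}(m)$ denotes the maximum inversion number of an oriented graph (equivalently, a tournament) on $m$ vertices (so $\operatorname{inv}(0)=0$). -}

module Defs where

open import Data.Nat using (ℕ; zero; suc; _≤_)
open import Data.Fin using (Fin)
open import Data.Bool using (Bool; true; false; _∧_; if_then_else_)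
open import Data.List using (List; []; _∷_; length; foldl)
open import Data.Product using (∃; _×_)
open import Relation.Nullary using (¬_)
open import Relation.Binary.PropositionalEquality using (_≡_)

Digraph : ℕ → Set
Digraph n = Fin n → Fin n → Bool

Oriented : ∀ {n} → Digraph n → Set
Oriented {n} E = (∀ (u : Fin n) → E u u ≡ false)
               × (∀ (u v : Fin n) → E u v ≡ true → E v u ≡ false)

VSet : ℕ → Set
VSet n = Fin n → Bool

invert : ∀ {n} → VSet n → Digraph n → Digraph n
invert X E u v = if X u ∧ X v then E v u else E u v

invertAll : ∀ {n} → List (VSet n) → Digraph n → Digraph n
invertAll Xs E = foldl (λ D X → invert X D) E Xs

data Walk⁺ {n} (E : Digraph n) : Fin n → Fin n → Set where
  arc  : ∀ {u v} → E u v ≡ true → Walk⁺ E u v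
  _∷ʷ_ : ∀ {u v w} → E u v ≡ true → Walk⁺ E v w → Walk⁺ E u w

Acyclic : ∀ {n} → Digraph n → Set
Acyclic {n} E = ∀ (v : Fin n) → ¬ Walk⁺ E v v

Decycling : ∀ {n} → Digraph n → List (VSet n) → Set
Decycling E Xs = Acyclic (invertAll Xs E)

InvAtMost : ∀ {n} → Digraph n → ℕ → Set
InvAtMost {n} E k = ∃ λ (Xs : List (VSet n)) → Decycling E Xs × length Xs ≤ k

-- inv(m) ≤ k  :⇔  every oriented graph on m vertices has inversion number ≤ k
-- (inv(m) is the maximum of inv(D) over oriented graphs D on m vertices).
MaxInvAtMost : ℕ → ℕ → Set
MaxInvAtMost m k = ∀ (E : Digraph m) → Oriented E → InvAtMost E k

-- Let n = 1 + p + m with p = ⌊(n-1)/2⌋ and m = ⌈(n-1)/2⌉ ≤ p + 1. The vertex 0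
-- has at most p out-neighbours or at most p in-neighbours, say (after reversing every arc)
-- at most p out-neighbours. One inversion removes any vertex b ≠ 0 from consideration
-- without touching the arcs at 0: invert the closed out-neighbourhood of b if 0 → b (b
-- becomes a sink) and its closed in-neighbourhood otherwise (b becomes a source). A sink
-- or source lies on no cycle, so it can be deleted, and the inversions used on the rest
-- lift back to the whole digraph. Doing this p times, always deleting an out-neighbour
-- of 0 while there is one, leaves 0 a sink of a digraph on m other vertices.
module Submission where

open import Defs
open import Data.Nat using (ℕ; zero; suc; _+_; _≤_; _∸_; ⌊_/2⌋; ⌈_/2⌉; z≤n; s≤s; s≤s⁻¹)
open import Data.Nat.Properties
  using (≤-trans; m≤n⇒m≤1+n; +-suc; ⌊n/2⌋+⌈n/2⌉≡n; +-mono-≤; +-monoʳ-≤; _≤?_; ≰⇒>; <-irrefl)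
open import Data.Fin using (Fin; zero; suc; punchIn; punchOut; _≟_)
open import Data.Fin.Properties using (punchIn-punchOut; punchOut-punchIn; punchOut-cong; punchInᵢ≢i)
open import Data.Bool using (Bool; true; false; _∧_; _∨_; if_then_else_)
open import Data.Bool.Properties using (∧-comm)
open import Data.List using (List; []; _∷_; map)
open import Data.List.Properties using (length-map)
open import Data.Product using (∃; _×_; _,_; proj₁; proj₂)
open import Data.Sum using (_⊎_; inj₁; inj₂)
open import Data.Empty using (⊥-elim)
open import Relation.Nullary using (yes; no; does)
open import Relation.Nullary.Decidable using (dec-false)
open import Relation.Binary.PropositionalEquality
  using (_≡_; _≢_; refl; sym; trans; cong; cong₂; subst; subst₂)

private
  variable
    n : ℕ

true≢false : true ≢ false
true≢false ()

_≐_ : Digraph n → Digraph n → Set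
F ≐ G = ∀ u v → F u v ≡ G u v

transpose : Digraph n → Digraph n
transpose E u v = E v u

deleteVertex : Fin (suc n) → Digraph (suc n) → Digraph n
deleteVertex b E i j = E (punchIn b i) (punchIn b j)

Sink : Digraph n → Fin n → Set
Sink E b = ∀ w → E b w ≡ false

Source : Digraph n → Fin n → Set
Source E = Sink (transpose E)

SinkOrSource : Digraph n → Fin n → Set
SinkOrSource E b = Sink E b ⊎ Source E b

module _ {E : Digraph n} where

  Walk⁺-head : ∀ {u w} → Walk⁺ E u w → ∃ λ v → E u v ≡ true
  Walk⁺-head (arc e)  = _ , e
  Walk⁺-head (e ∷ʷ _) = _ , e

  Walk⁺-snoc : ∀ {u v w} → Walk⁺ E u v → E v w ≡ true → Walk⁺ E u w
  Walk⁺-snoc (arc e)  e′ = e ∷ʷ arc e′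
  Walk⁺-snoc (e ∷ʷ r) e′ = e ∷ʷ Walk⁺-snoc r e′

Walk⁺-reverse : ∀ {E : Digraph n} {u w} → Walk⁺ E u w → Walk⁺ (transpose E) w u
Walk⁺-reverse (arc e)  = arc e
Walk⁺-reverse (e ∷ʷ r) = Walk⁺-snoc (Walk⁺-reverse r) e

Walk⁺-resp : ∀ {F G : Digraph n} → F ≐ G → ∀ {u w} → Walk⁺ F u w → Walk⁺ G u w
Walk⁺-resp F≐G (arc {u} {v} e)    = arc (trans (sym (F≐G u v)) e)
Walk⁺-resp F≐G (_∷ʷ_ {u} {v} e r) = trans (sym (F≐G u v)) e ∷ʷ Walk⁺-resp F≐G r

Acyclic-resp : ∀ {F G : Digraph n} → F ≐ G → Acyclic G → Acyclic F
Acyclic-resp F≐G acyclic v cycle = acyclic v (Walk⁺-resp F≐G cycle)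

Acyclic-transpose : ∀ {E : Digraph n} → Acyclic (transpose E) → Acyclic E
Acyclic-transpose acyclic v cycle = acyclic v (Walk⁺-reverse cycle)

-- A walk through a sink would have to leave it, so walks between other vertices avoid it.
Walk⁺-deleteSink : ∀ {F : Digraph (suc n)} {b} → Sink F b → ∀ {u w} → Walk⁺ F u w →
                   (b≢u : b ≢ u) (b≢w : b ≢ w) →
                   Walk⁺ (deleteVertex b F) (punchOut b≢u) (punchOut b≢w)
Walk⁺-deleteSink {F = F} sink (arc e) b≢u b≢w =
  arc (subst₂ (λ x y → F x y ≡ true) (sym (punchIn-punchOut b≢u)) (sym (punchIn-punchOut b≢w)) e)
Walk⁺-deleteSink {F = F} {b} sink (_∷ʷ_ {v = v} e r) b≢u b≢w with b ≟ v
... | yes refl = ⊥-elim (true≢false (trans (sym (proj₂ (Walk⁺-head r))) (sink _)))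
... | no b≢v   =
  subst₂ (λ x y → F x y ≡ true) (sym (punchIn-punchOut b≢u)) (sym (punchIn-punchOut b≢v)) e
  ∷ʷ Walk⁺-deleteSink sink r b≢v b≢w

Acyclic-deleteSink : ∀ {F : Digraph (suc n)} {b} → Sink F b →
                     Acyclic (deleteVertex b F) → Acyclic F
Acyclic-deleteSink {b = b} sink acyclic u cycle with b ≟ u
... | yes refl = true≢false (trans (sym (proj₂ (Walk⁺-head cycle))) (sink _))
... | no b≢u   = acyclic (punchOut b≢u) (Walk⁺-deleteSink sink cycle b≢u b≢u)

invert-transpose : ∀ (X : VSet n) {D D′} → D′ ≐ transpose D →
                   invert X D′ ≐ transpose (invert X D)
invert-transpose X D′≐Dᵀ u v rewrite ∧-comm (X u) (X v) with X v ∧ X u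
... | true  = D′≐Dᵀ v u
... | false = D′≐Dᵀ u v

invertAll-transpose : ∀ (Xs : List (VSet n)) {D D′} → D′ ≐ transpose D →
                      invertAll Xs D′ ≐ transpose (invertAll Xs D)
invertAll-transpose []       D′≐Dᵀ = D′≐Dᵀ
invertAll-transpose (X ∷ Xs) D′≐Dᵀ = invertAll-transpose Xs (invert-transpose X D′≐Dᵀ)

Decycling-transpose : ∀ {E : Digraph n} {Xs : List (VSet n)} →
                      Decycling (transpose E) Xs → Decycling E Xs
Decycling-transpose {Xs = Xs} decycling =
  Acyclic-transpose (Acyclic-resp (λ u v → sym (invertAll-transpose Xs (λ _ _ → refl) u v)) decycling)

InvAtMost-transpose : ∀ {E : Digraph n} {k} → InvAtMost (transpose E) k → InvAtMost E k
InvAtMost-transpose {E = E} (Xs , decycling , |Xs|≤k) =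
  Xs , Decycling-transpose {E = E} {Xs} decycling , |Xs|≤k

InvAtMost-invert : ∀ {E : Digraph n} X {k} → InvAtMost (invert X E) k → InvAtMost E (suc k)
InvAtMost-invert X (Xs , decycling , |Xs|≤k) = X ∷ Xs , decycling , s≤s |Xs|≤k

invert-outside : ∀ (X : VSet n) E {a} → X a ≡ false → ∀ w → invert X E a w ≡ E a w
invert-outside X E Xa≡false w rewrite Xa≡false = refl

lift : Fin (suc n) → VSet n → VSet (suc n)
lift b Y w with b ≟ w
... | yes _   = false
... | no b≢w = Y (punchOut b≢w)

lift-at : ∀ b (Y : VSet n) → lift b Y b ≡ false
lift-at b Y with b ≟ b
... | yes _   = refl
... | no b≢b = ⊥-elim (b≢b refl)

lift-punchIn : ∀ b (Y : VSet n) j → lift b Y (punchIn b j) ≡ Y j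
lift-punchIn b Y j with b ≟ punchIn b j
... | yes b≡ = ⊥-elim (punchInᵢ≢i b j (sym b≡))
... | no b≢  = cong Y (trans (punchOut-cong b refl) (punchOut-punchIn b))

invertAll-lift-sink : ∀ b (Ys : List (VSet n)) {D} → Sink D b →
                      Sink (invertAll (map (lift b) Ys) D) b
invertAll-lift-sink b []       sink = sink
invertAll-lift-sink b (Y ∷ Ys) {D} sink = invertAll-lift-sink b Ys λ w →
  trans (invert-outside (lift b Y) D (lift-at b Y) w) (sink w)

invertAll-lift-delete : ∀ b (Ys : List (VSet n)) {D D′} → D′ ≐ deleteVertex b D →
                        invertAll Ys D′ ≐ deleteVertex b (invertAll (map (lift b) Ys) D)
invertAll-lift-delete b []       D′≐ = D′≐
invertAll-lift-delete b (Y ∷ Ys) {D} {D′} D′≐ = invertAll-lift-delete b Ys invert-≐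
  where
  invert-≐ : invert Y D′ ≐ deleteVertex b (invert (lift b Y) D)
  invert-≐ i j rewrite lift-punchIn b Y i | lift-punchIn b Y j with Y i ∧ Y j
  ... | true  = D′≐ j i
  ... | false = D′≐ i j

Decycling-lift-sink : ∀ {E : Digraph (suc n)} {b} Ys → Sink E b →
                      Decycling (deleteVertex b E) Ys → Decycling E (map (lift b) Ys)
Decycling-lift-sink {b = b} Ys sink decycling =
  Acyclic-deleteSink (invertAll-lift-sink b Ys sink)
    (Acyclic-resp (λ i j → sym (invertAll-lift-delete b Ys (λ _ _ → refl) i j)) decycling)

InvAtMost-deleteVertex : ∀ {E : Digraph (suc n)} {b k} → SinkOrSource E b →
                         InvAtMost (deleteVertex b E) k → InvAtMost E k
InvAtMost-deleteVertex {E = E} {b} sinkOrSource (Ys , decycling , |Ys|≤k) =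
  map (lift b) Ys , lifted sinkOrSource , subst (_≤ _) (sym (length-map (lift b) Ys)) |Ys|≤k
  where
  lifted : SinkOrSource E b → Decycling E (map (lift b) Ys)
  lifted (inj₁ sink)   = Decycling-lift-sink Ys sink decycling
  lifted (inj₂ source) = Decycling-transpose {E = E} {map (lift b) Ys}
    (Decycling-lift-sink Ys source
      (Decycling-transpose {E = deleteVertex b (transpose E)} {Ys} decycling))

Oriented-transpose : ∀ {E : Digraph n} → Oriented E → Oriented (transpose E)
Oriented-transpose (loopless , antisymmetric) = loopless , λ u v → antisymmetric v u

Oriented-deleteVertex : ∀ {E : Digraph (suc n)} b → Oriented E → Oriented (deleteVertex b E)
Oriented-deleteVertex b (loopless , antisymmetric) =
  (λ _ → loopless _) , (λ _ _ → antisymmetric _ _)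

Oriented-invert : ∀ (X : VSet n) {E} → Oriented E → Oriented (invert X E)
Oriented-invert X {E} (loopless , antisymmetric) = invert-loopless , invert-antisymmetric
  where
  invert-loopless : ∀ u → invert X E u u ≡ false
  invert-loopless u with X u ∧ X u
  ... | true  = loopless u
  ... | false = loopless u
  invert-antisymmetric : ∀ u v → invert X E u v ≡ true → invert X E v u ≡ false
  invert-antisymmetric u v rewrite ∧-comm (X v) (X u) with X u ∧ X v
  ... | true  = antisymmetric v u
  ... | false = antisymmetric u v

closedOutNeighbourhood : Digraph n → Fin n → VSet n
closedOutNeighbourhood E b w = does (w ≟ b) ∨ E b w

-- Arcs b → w with w outside the set are absent, and those inside are reversed.
invert-closedOutNeighbourhood-sink : ∀ {E : Digraph n} → Oriented E → ∀ b →
                                     Sink (invert (closedOutNeighbourhood E b) E) b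
invert-closedOutNeighbourhood-sink {E = E} (loopless , antisymmetric) b w with b ≟ b
... | no b≢b = ⊥-elim (b≢b refl)
... | yes _ with w ≟ b
...   | yes refl = loopless b
...   | no _ with E b w in bw
...     | true  = antisymmetric b w bw
...     | false = refl

-- a is not an out-neighbour of b when a → b, and not an in-neighbour of b otherwise.
isolate : ∀ {E : Digraph n} → Oriented E → ∀ {a b} → a ≢ b →
          ∃ λ X → SinkOrSource (invert X E) b × X a ≡ false
isolate {E = E} oriented {a} {b} a≢b with E a b in ab
... | true  = closedOutNeighbourhood E b
            , inj₁ (invert-closedOutNeighbourhood-sink oriented b)
            , cong₂ _∨_ (dec-false (a ≟ b) a≢b) (proj₂ oriented a b ab)
... | false = closedOutNeighbourhood (transpose E) b
            , inj₂ (λ w → trans (sym (invert-transpose X {E} (λ _ _ → refl) b w))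
                                (invert-closedOutNeighbourhood-sink (Oriented-transpose oriented) b w))
            , cong₂ _∨_ (dec-false (a ≟ b) a≢b) ab
  where X = closedOutNeighbourhood (transpose E) b

count : (Fin n → Bool) → ℕ
count {zero}  P = 0
count {suc n} P = if P zero then suc (count (λ i → P (suc i))) else count (λ i → P (suc i))

count-cong : ∀ {P Q : Fin n → Bool} → (∀ i → P i ≡ Q i) → count P ≡ count Q
count-cong {zero}  P≡Q = refl
count-cong {suc n} P≡Q rewrite P≡Q zero | count-cong (λ i → P≡Q (suc i)) = refl

count≤0⇒false : ∀ (P : Fin n → Bool) → count P ≤ 0 → ∀ i → P i ≡ false
count≤0⇒false {suc n} P count≤0 i with P zero in P0 | i
count≤0⇒false {suc n} P () i | true  | _
... | false | zero  = P0
... | false | suc j = count≤0⇒false (λ i → P (suc i)) count≤0 j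

count-disjoint : ∀ (P Q : Fin n → Bool) → (∀ i → P i ≡ true → Q i ≡ false) →
                 count P + count Q ≤ n
count-disjoint {zero}  P Q disjoint = z≤n
count-disjoint {suc n} P Q disjoint with P zero in P0 | Q zero in Q0
... | true  | true  = ⊥-elim (true≢false (trans (sym Q0) (disjoint zero P0)))
... | true  | false = s≤s (count-disjoint _ _ (λ i → disjoint (suc i)))
... | false | true  = subst (_≤ suc n) (sym (+-suc (count (λ i → P (suc i))) _))
                            (s≤s (count-disjoint _ _ (λ i → disjoint (suc i))))
... | false | false = m≤n⇒m≤1+n (count-disjoint _ _ (λ i → disjoint (suc i)))

-- Skipping a true position if there is one, and any position otherwise.
count-punchIn-≤ : ∀ {p} (P : Fin (suc n) → Bool) → count P ≤ suc p →
                  ∃ λ k → count (λ j → P (punchIn k j)) ≤ p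
count-punchIn-≤ {zero}  P _ = zero , z≤n
count-punchIn-≤ {suc n} P count≤ with P zero in P0
... | true  = zero , s≤s⁻¹ count≤
... | false with count-punchIn-≤ (λ i → P (suc i)) count≤
...   | k , count≤p = suc k , subst (λ b → (if b then suc c else c) ≤ _) (sym P0) count≤p
  where c = count (λ j → P (suc (punchIn k j)))

peel : ∀ p {m k} → MaxInvAtMost m k → (E : Digraph (suc (p + m))) → Oriented E →
       count (λ i → E zero (suc i)) ≤ p → InvAtMost E (p + k)
peel zero bound E oriented outdeg≤0 =
  InvAtMost-deleteVertex (inj₁ sink)
    (bound (deleteVertex zero E) (Oriented-deleteVertex zero oriented))
  where
  sink : Sink E zero
  sink zero    = proj₁ oriented zero
  sink (suc i) = count≤0⇒false _ outdeg≤0 i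
peel (suc p) bound E oriented outdeg≤ with count-punchIn-≤ (λ i → E zero (suc i)) outdeg≤
... | k , outdeg′≤ with isolate oriented {zero} {suc k} (λ ())
...   | X , sinkOrSource , X0≡false =
  InvAtMost-invert X (InvAtMost-deleteVertex sinkOrSource (peel p bound E′ oriented′ outdegE′≤))
  where
  E′ = deleteVertex (suc k) (invert X E)
  oriented′ : Oriented E′
  oriented′ = Oriented-deleteVertex (suc k) (Oriented-invert X oriented)
  outdegE′≤ : count (λ i → E′ zero (suc i)) ≤ p
  outdegE′≤ = subst (_≤ p)
    (sym (count-cong (λ i → invert-outside X E X0≡false (suc (punchIn k i))))) outdeg′≤

m+n≤p+1+p⇒m≤p⊎n≤p : ∀ m n p → m + n ≤ p + suc p → m ≤ p ⊎ n ≤ p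
m+n≤p+1+p⇒m≤p⊎n≤p m n p m+n≤ with m ≤? p | n ≤? p
... | yes m≤p | _       = inj₁ m≤p
... | no _    | yes n≤p = inj₂ n≤p
... | no m≰p  | no n≰p  =
  ⊥-elim (<-irrefl refl (≤-trans (+-mono-≤ (≰⇒> m≰p) (≰⇒> n≰p)) m+n≤))

MaxInvAtMost-step : ∀ p {m k} → m ≤ suc p → MaxInvAtMost m k →
                    MaxInvAtMost (suc (p + m)) (p + k)
MaxInvAtMost-step p {m} m≤1+p bound E oriented
  with m+n≤p+1+p⇒m≤p⊎n≤p (count (λ i → E zero (suc i))) (count (λ i → E (suc i) zero)) p
         (≤-trans (count-disjoint _ _ (λ i → proj₂ oriented zero (suc i))) (+-monoʳ-≤ p m≤1+p))
... | inj₁ outdeg≤p = peel p bound E oriented outdeg≤p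
... | inj₂ indeg≤p  =
  InvAtMost-transpose {E = E} (peel p bound (transpose E) (Oriented-transpose oriented) indeg≤p)

⌈n/2⌉≤1+⌊n/2⌋ : ∀ n → ⌈ n /2⌉ ≤ suc ⌊ n /2⌋
⌈n/2⌉≤1+⌊n/2⌋ zero          = z≤n
⌈n/2⌉≤1+⌊n/2⌋ (suc zero)    = s≤s z≤n
⌈n/2⌉≤1+⌊n/2⌋ (suc (suc n)) = s≤s (⌈n/2⌉≤1+⌊n/2⌋ n)

proposition7p2 : ∀ (n : ℕ) → 1 ≤ n → ∀ (b : ℕ) →
    MaxInvAtMost ⌈ n ∸ 1 /2⌉ b → MaxInvAtMost n (⌊ n ∸ 1 /2⌋ + b)
proposition7p2 (suc n) _ b bound =
  subst (λ n′ → MaxInvAtMost (suc n′) (⌊ n /2⌋ + b)) (⌊n/2⌋+⌈n/2⌉≡n n)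
    (MaxInvAtMost-step ⌊ n /2⌋ (⌈n/2⌉≤1+⌊n/2⌋ n) bound)
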